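{- Let $\mathcal{G}$ be a game with Borel objective, let $S_1,\dots,S_n$ be a partition of the states controlled by $\mathtt{Sat}$, and let $I\subseteq\{1,\dots,n\}$ be such that $I(S_j)=0$ for every $j\notin I$. Then for every $i\in I$, \[ I(S_i)=\frac{1}{|I|!}\sum_{\substack{J\subseteq I\\ (i,J)\text{ critical}}}|J|!\,(|I|-|J|-1)!.\]
   Context: A game is given by a finite directed graph $(S,\Delta)$ in which every state has at least one successor, a partition of $S$ into $S_{\mathtt{Sat}}$ and $S_{\mathtt{Unsat}}$, an initial state, and a Borel objective $\Omega\subseteq S^\omega$; $\mathtt{Sat}$ wins a play iff it lies in $\Omega$. For $T\subseteq S$, $\mathrm{val}(T)=1$ if $\mathtt{Sat}$ has a winning strategy in the game on the same graph, initial state and objective in which $\mathtt{Sat}$ controls $T$ and $\mathtt{Unsat}$ controls $S\setminus T$, and $\mathrm{val}(T)=0$ otherwise. Given a partition $S_1,\dots,S_n$ of $S_{\mathtt{Sat}}$, the importance of $S_i$ is $I(S_i)=\frac{1}{n!}\sum_{\pi\in\Pi_n}\big(\mathrm{val}(S^\pi_{\ge i})-\mathrm{val}(S^\pi_{\ge i}\setminus S_i)\big)$, where $\Pi_n$ is the set of permutations of $\{1,\dots,n\}$ and $S^\pi_{\ge i}=\bigcup_{\pi(j)\ge\pi(i)}S_j$. A pair $(i,J)$ with $i\in\{1,\dots,n\}$, $J\subseteq\{1,\dots,n\}$ is critical if $\mathrm{val}(\bigcup_{j\in J\cup\{i\}}S_j)=1$ and $\mathrm{val}(\bigcup_{j\in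 J}S_j)=0$ (in particular $i\notin J$). -}

module Defs where

open import Data.Nat using (ℕ; zero; suc; _∸_; _!; _≤ᵇ_)
open import Data.Nat.Properties using (_!≢0)
open import Data.Bool using (Bool; true; false; if_then_else_; _∧_; not)
open import Data.Fin using (Fin; toℕ; _≟_)
open import Data.Fin.Subset using (Subset)
open import Data.Vec using (Vec; []; _∷_; lookup; tabulate)
open import Data.List using (List; []; _∷_; _++_; map; foldr; filter; length)
import Data.List as L
import Data.Bool.ListAction
open import Data.Fin.Subset using (_⊆_; ∣_∣)
open import Data.Fin.Subset.Properties using (_⊆?_)
import Data.Rational.Properties as ℚP
open import Relation.Nullary.Decidable using (_×-dec_)
open import Data.Maybe using (Maybe; just; nothing)
open import Data.Product using (Σ; _×_; _,_; proj₁; proj₂)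
open import Data.Integer using (+_)
open import Data.Rational using (ℚ; 0ℚ; 1ℚ; _+_; _-_; _*_; _/_)
open import Relation.Nullary using (¬_; Dec; yes; no; does)
open import Relation.Binary.PropositionalEquality using (_≡_)
open import Function using (_⇔_)

Play : ℕ → Set
Play m = ℕ → Fin m

prefix : ∀ {m} → Play m → ℕ → List (Fin m)
prefix p k = L.tabulate {n = k} (λ i → p (toℕ i))

-- Borel subsets of S^ω (product topology of the discrete finite S):
-- the σ-algebra generated by the cylinder sets w·S^ω.
data Borel {m : ℕ} : (Play m → Set) → Set₁ where
  cylinder : (w : List (Fin m)) → Borel (λ p → prefix p (length w) ≡ w)
  complement : ∀ {A} → Borel A → Borel (λ p → ¬ A p)
  countableUnion : (A : ℕ → Play m → Set) → (∀ k → Borel (A k)) →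
                   Borel (λ p → Σ ℕ λ k → A k p)
  extensional : ∀ {A B} → Borel A → (∀ p → A p ⇔ B p) → Borel B

record Game (m : ℕ) : Set₁ where
  field
    Δ       : Fin m → Fin m → Bool
    total   : ∀ s → Σ (Fin m) λ t → Δ s t ≡ true
    initial : Fin m
    Ω       : Play m → Set
    borel   : Borel Ω

-- A strategy maps the history (previously visited states, most recent
-- first) and the current state to the next state.
Strategy : ℕ → Set
Strategy m = List (Fin m) → Fin m → Fin m

module _ {m : ℕ} (G : Game m) where
  open Game G

  Legal : Strategy m → Set
  Legal σ = ∀ h s → Δ s (σ h s) ≡ true

  -- configuration after k steps when Sat controls T (Unsat the rest),
  -- Sat plays σ and Unsat plays τ: (history, current state)
  config : (T : Fin m → Bool) → Strategy m → Strategy m → ℕ → List (Fin m) × Fin m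
  config T σ τ zero = [] , initial
  config T σ τ (suc k) with config T σ τ k
  ... | h , s = (s ∷ h) , (if T s then σ h s else τ h s)

  outcome : (T : Fin m → Bool) → Strategy m → Strategy m → Play m
  outcome T σ τ k = proj₂ (config T σ τ k)

  SatWins : (Fin m → Bool) → Set
  SatWins T = Σ (Strategy m) λ σ → Legal σ ×
                (∀ τ → Legal τ → Ω (outcome T σ τ))

  -- val(T) ∈ {0,1}, given a decision of who wins each game
  -- (classically every such proposition is decidable).
  val : (∀ T → Dec (SatWins T)) → (Fin m → Bool) → ℚ
  val dec T = if does (dec T) then 1ℚ else 0ℚ

-- blk s = just j  :  s ∈ S_Sat and s ∈ S_j ;  blk s = nothing : s ∈ S_Unsat
IsPartition : ∀ {m} n → (Fin m → Maybe (Fin n)) → Set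
IsPartition {m} n blk = ∀ (j : Fin n) → Σ (Fin m) λ s → blk s ≡ just j

blocks : ∀ {m n} → (Fin m → Maybe (Fin n)) → Subset n → (Fin m → Bool)
blocks blk J s with blk s
... | just j  = lookup J j
... | nothing = false

sumℚ : List ℚ → ℚ
sumℚ = foldr _+_ 0ℚ

sumℕ : List ℕ → ℕ
sumℕ = foldr Data.Nat._+_ 0

allFuns : (k n : ℕ) → List (Fin k → Fin n)
allFuns zero n = (λ ()) ∷ []
allFuns (suc k) n =
  L.concatMap (λ f → map (λ (x : Fin n) → λ { Fin.zero → x ; (Fin.suc i) → f i })
                         (L.allFin n))
              (allFuns k n)

isInjective : ∀ {n} → (Fin n → Fin n) → Bool
isInjective {n} f =
  Data.Bool.ListAction.and (L.concatMap (λ i → map (λ j → not (does (f i ≟ f j)) Data.Bool.∨ does (i ≟ j))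
                                (L.allFin n))
                     (L.allFin n))

permutations : (n : ℕ) → List (Fin n → Fin n)
permutations n = filter (λ f → isInjective f Data.Bool.≟ true) (allFuns n n)

allSubsets : (n : ℕ) → List (Subset n)
allSubsets zero = [] ∷ []
allSubsets (suc n) = map (true ∷_) (allSubsets n) ++ map (false ∷_) (allSubsets n)

module _ {m : ℕ} (G : Game m) (dec : ∀ T → Dec (SatWins G T))
         {n : ℕ} (blk : Fin m → Maybe (Fin n)) where

  valB : Subset n → ℚ
  valB J = val G dec (blocks blk J)

  geq : (Fin n → Fin n) → Fin n → Subset n
  geq π i = tabulate (λ j → toℕ (π i) ≤ᵇ toℕ (π j))

  geqMinus : (Fin n → Fin n) → Fin n → Subset n
  geqMinus π i = tabulate (λ j → (toℕ (π i) ≤ᵇ toℕ (π j)) ∧ not (does (j ≟ i)))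

  importance : Fin n → ℚ
  importance i =
    (+ 1 / (n !)) {{n !≢0}} *
    sumℚ (map (λ π → valB (geq π i) - valB (geqMinus π i)) (permutations n))

  Critical : Fin n → Subset n → Set
  Critical i J = (valB (Data.Fin.Subset._∪_ J (Data.Fin.Subset.⁅_⁆ i)) ≡ 1ℚ) × (valB J ≡ 0ℚ)

  critical? : (i : Fin n) (J : Subset n) → Dec (Critical i J)
  critical? i J = (valB (Data.Fin.Subset._∪_ J (Data.Fin.Subset.⁅_⁆ i)) ℚP.≟ 1ℚ)
                  ×-dec (valB J ℚP.≟ 0ℚ)

  criticalSum : Subset n → Fin n → ℕ
  criticalSum I i =
    sumℕ (map (λ J → Data.Nat._*_ (∣ J ∣ !) ((∣ I ∣ ∸ ∣ J ∣ ∸ 1) !))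
              (filter (λ J → (J ⊆? I) ×-dec critical? i J) (allSubsets n)))

-- The importance of a block is its Shapley value in the simple game J ↦ val(⋃_{j∈J} S_j).
-- Grouping the n! orders by the set J of blocks ranked after S_i gives
-- n! · I(S_i) = Σ_{(i,J) critical} |J|! (n - |J| - 1)!; the orders with a given J are counted
-- as the bijections sending the blocks before S_i, S_i itself and the blocks after it to the
-- positions below, at and above some r, which only exist for r = n - |J| - 1.
-- A block of importance zero is critical for no coalition, so by monotonicity of winning it
-- never changes the winner. Adding such a null block j to a set P multiplies the critical sum
-- over subsets of P by |P| + 1: the coalitions J and J ∪ {j} are critical together and
-- a! (p - a)! + (a + 1)! (p - a - 1)! = (p + 1) · a! (p - a - 1)!. Adding the null blocks
-- outside I one at a time turns the formula for all n blocks into the formula for I.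

module Submission where

open import Defs
import Data.Nat.Properties as ℕP
open import Data.Nat.Properties using (_!≢0)
open import Algebra.Properties.CommutativeSemigroup ℕP.+-commutativeSemigroup
  using () renaming (interchange to +-interchange)
open import Algebra.Properties.CommutativeSemigroup ℕP.*-commutativeSemigroup
  using () renaming (x∙yz≈y∙xz to *-left-comm)
open import Algebra.Properties.Semiring.Sum ℕP.+-*-semiring
  using (sum; sum-syntax; sum-cong-≗; sum-replicate-zero; sum-remove; ∑-comm; ∑-distrib-+; *-distribˡ-sum)
open import Data.Bool using (Bool; true; false; T; if_then_else_; _∧_; _∨_; not)
import Data.Bool as Bool
import Data.Bool.ListAction as BoolList
import Data.Bool.Properties as BoolP
open import Data.Empty using (⊥-elim)
open import Data.Fin using (Fin; zero; suc; toℕ; fromℕ<; _≟_)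
open import Data.Fin.Patterns using (0F; 1F; 2F)
import Data.Fin.Properties as FinP
open import Data.Fin.Subset using (Subset; inside; outside; _∈_; _∉_; _⊆_; _∪_; ⁅_⁆; ⊤; ∣_∣)
open import Data.Fin.Subset.Properties using (_⊆?_; _∈?_)
import Data.Fin.Subset.Properties as SubsetP
import Data.Integer as ℤ
import Data.Integer.Properties as ℤP
open import Data.Integer.Tactic.RingSolver using () renaming (solve-∀ to ℤ-solve-∀)
open import Data.List using (List; []; _∷_; _++_; map; filter; concatMap; allFin)
import Data.List as List
import Data.List.Membership.Propositional.Properties as ∈ListP
import Data.List.Properties as ListP
import Data.List.Relation.Unary.All as All
import Data.List.Relation.Unary.All.Properties as AllP
open import Data.Maybe using (Maybe; just; nothing)
open import Data.Nat using (ℕ; zero; suc; _+_; _*_; _∸_; _!; _≤_; _<_; _≤ᵇ_; _<ᵇ_; s≤s; z≤n; NonZero)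
open import Data.Nat.Combinatorics.Base using (_P′_)
open import Data.Nat.Combinatorics.Specification using (nP′n≡n!)
import Data.Nat.ListAction.Properties as ListSum
open import Data.Nat.Tactic.RingSolver using (solve-∀)
open import Data.Product using (∃; _×_; _,_; proj₁; proj₂)
open import Data.Rational using (0ℚ; 1ℚ; _/_; toℚᵘ)
import Data.Rational as ℚ
import Data.Rational.Properties as ℚP
open import Data.Rational.Unnormalised using (mkℚᵘ; *≡*)
import Data.Rational.Unnormalised as ℚᵘ
import Data.Rational.Unnormalised.Properties as ℚᵘP
open import Data.Sum using (inj₁; inj₂)
open import Data.Vec using (Vec; []; _∷_; lookup; tabulate; here; there)
import Data.Vec.Functional as Vector
import Data.Vec.Properties as VecP
open import Function using (_∘_; _⇔_; mk⇔; Equivalence; case_of_)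
open import Function.Construct.Composition using (_⇔-∘_)
open import Function.Construct.Symmetry using (⇔-sym)
open import Function.Definitions using (Injective)
open import Relation.Binary.Definitions using (tri<; tri≈; tri>)
open import Relation.Binary.PropositionalEquality
open import Relation.Nullary using (¬_; Dec; yes; no; does; ¬?; _×-dec_; _→-dec_; contradiction)
open import Relation.Nullary.Decidable using (map′; dec-true; dec-false; does-⇔; decidable-stable)

𝟙 : Bool → ℕ
𝟙 true  = 1
𝟙 false = 0

𝟙-∧ : ∀ a b → 𝟙 (a ∧ b) ≡ 𝟙 a * 𝟙 b
𝟙-∧ true  b = sym (ℕP.+-identityʳ (𝟙 b))
𝟙-∧ false b = refl

𝟙-not : ∀ b → 𝟙 (not b) + 𝟙 b ≡ 1
𝟙-not true  = refl
𝟙-not false = refl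

sum-zero : ∀ {n} (h : Fin n → ℕ) → (∀ x → h x ≡ 0) → sum h ≡ 0
sum-zero {n} h h≡0 = trans (sum-cong-≗ h≡0) (sum-replicate-zero n)

sum-unique : ∀ {n} (h : Fin n → ℕ) (a : Fin n) → (∀ x → x ≢ a → h x ≡ 0) → sum h ≡ h a
sum-unique {suc n} h a others = begin
  sum h                                  ≡⟨ sum-remove {i = a} h ⟩
  h a + sum (Vector.removeAt h a)           ≡⟨ cong (h a +_) (sum-zero _ (λ x → others _ (FinP.punchInᵢ≢i a x))) ⟩
  h a + 0                                ≡⟨ ℕP.+-identityʳ (h a) ⟩
  h a                                    ∎
  where open ≡-Reasoning

sum-const-1 : ∀ n → ∑[ x < n ] 1 ≡ n
sum-const-1 zero    = refl
sum-const-1 (suc n) = cong suc (sum-const-1 n)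

private
  variable
    A B : Set

sumOver : List A → (A → ℕ) → ℕ
sumOver xs h = sumℕ (map h xs)

sumOver-cong : ∀ (xs : List A) {g h : A → ℕ} → (∀ x → g x ≡ h x) → sumOver xs g ≡ sumOver xs h
sumOver-cong xs g≗h = cong sumℕ (ListP.map-cong g≗h xs)

sumOver-++ : ∀ (xs ys : List A) h → sumOver (xs ++ ys) h ≡ sumOver xs h + sumOver ys h
sumOver-++ xs ys h = trans (cong sumℕ (ListP.map-++ h xs ys)) (ListSum.sum-++ (map h xs) (map h ys))

sumOver-map : ∀ (xs : List B) (f : B → A) h → sumOver (map f xs) h ≡ sumOver xs (h ∘ f)
sumOver-map xs f h = cong sumℕ (sym (ListP.map-∘ xs))

sumOver-concatMap : ∀ (xs : List B) (f : B → List A) h →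
                    sumOver (concatMap f xs) h ≡ sumOver xs (λ x → sumOver (f x) h)
sumOver-concatMap []       f h = refl
sumOver-concatMap (x ∷ xs) f h =
  trans (sumOver-++ (f x) _ h) (cong (sumOver (f x) h +_) (sumOver-concatMap xs f h))

sumOver-filter : ∀ {P : A → Set} (P? : ∀ x → Dec (P x)) (xs : List A) h →
                 sumOver (filter P? xs) h ≡ sumOver xs (λ x → 𝟙 (does (P? x)) * h x)
sumOver-filter P? []       h = refl
sumOver-filter P? (x ∷ xs) h with does (P? x)
... | true  = cong₂ _+_ (sym (ℕP.+-identityʳ (h x))) (sumOver-filter P? xs h)
... | false = sumOver-filter P? xs h

sumOver-zero : ∀ (xs : List A) h → (∀ x → h x ≡ 0) → sumOver xs h ≡ 0
sumOver-zero []       h h≡0 = refl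
sumOver-zero (x ∷ xs) h h≡0 = cong₂ _+_ (h≡0 x) (sumOver-zero xs h h≡0)

sumOver-+ : ∀ (xs : List A) g h → sumOver xs (λ x → g x + h x) ≡ sumOver xs g + sumOver xs h
sumOver-+ []       g h = refl
sumOver-+ (x ∷ xs) g h = trans (cong (g x + h x +_) (sumOver-+ xs g h)) (+-interchange (g x) (h x) _ _)

sumOver-*ˡ : ∀ (xs : List A) c h → sumOver xs (λ x → c * h x) ≡ c * sumOver xs h
sumOver-*ˡ []       c h = sym (ℕP.*-zeroʳ c)
sumOver-*ˡ (x ∷ xs) c h =
  trans (cong (c * h x +_) (sumOver-*ˡ xs c h)) (sym (ℕP.*-distribˡ-+ c (h x) _))

sumOver-comm : ∀ (xs : List A) (ys : List B) (h : A → B → ℕ) →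
               sumOver xs (λ x → sumOver ys (h x)) ≡ sumOver ys (λ y → sumOver xs (λ x → h x y))
sumOver-comm []       ys h = sym (sumOver-zero ys _ (λ _ → refl))
sumOver-comm (x ∷ xs) ys h =
  trans (cong (sumOver ys (h x) +_) (sumOver-comm xs ys h)) (sym (sumOver-+ ys (h x) _))

sumOver-comm-∑ : ∀ (xs : List A) n (h : A → Fin n → ℕ) →
                 sumOver xs (λ x → ∑[ y < n ] h x y) ≡ ∑[ y < n ] sumOver xs (λ x → h x y)
sumOver-comm-∑ []       n h = sym (sum-replicate-zero n)
sumOver-comm-∑ (x ∷ xs) n h =
  trans (cong (sum (h x) +_) (sumOver-comm-∑ xs n h)) (sym (∑-distrib-+ (h x) _))

sumOver-allFin : ∀ n (h : Fin n → ℕ) → sumOver (allFin n) h ≡ sum h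
sumOver-allFin n h = trans (cong sumℕ (ListP.map-tabulate (λ x → x) h)) (sum-tabulate n h)
  where
  sum-tabulate : ∀ n (h : Fin n → ℕ) → sumℕ (List.tabulate h) ≡ sum h
  sum-tabulate zero    h = refl
  sum-tabulate (suc n) h = cong (h zero +_) (sum-tabulate n (h ∘ suc))

∑ˢ : ∀ {n} → (Subset n → ℕ) → ℕ
∑ˢ {n} = sumOver (allSubsets n)

infix 4 _≟ˢ_
_≟ˢ_ : ∀ {n} (J K : Subset n) → Dec (J ≡ K)
_≟ˢ_ = VecP.≡-dec Bool._≟_

∑ˢ-zero : ∀ {n} {h : Subset n → ℕ} → (∀ J → h J ≡ 0) → ∑ˢ h ≡ 0
∑ˢ-zero {n} {h} = sumOver-zero (allSubsets n) h

∑ˢ-suc : ∀ {n} (h : Subset (suc n) → ℕ) →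
         ∑ˢ h ≡ ∑ˢ (λ J → h (inside ∷ J)) + ∑ˢ (λ J → h (outside ∷ J))
∑ˢ-suc {n} h = trans (sumOver-++ (map (inside ∷_) (allSubsets n)) _ h)
                     (cong₂ _+_ (sumOver-map (allSubsets n) _ h) (sumOver-map (allSubsets n) _ h))

∑ˢ-indicator : ∀ {n} (K : Subset n) (h : Subset n → ℕ) → ∑ˢ (λ J → 𝟙 (does (K ≟ˢ J)) * h J) ≡ h K
∑ˢ-indicator []              h = trans (ℕP.+-identityʳ _) (ℕP.*-identityˡ (h []))
∑ˢ-indicator {suc n} (inside ∷ K) h =
  trans (∑ˢ-suc (λ J → 𝟙 (does (inside ∷ K ≟ˢ J)) * h J))
        (trans (cong₂ _+_ (∑ˢ-indicator K (h ∘ (inside ∷_))) (∑ˢ-zero {n} (λ _ → refl))) (ℕP.+-identityʳ _))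
∑ˢ-indicator {suc n} (outside ∷ K) h =
  trans (∑ˢ-suc (λ J → 𝟙 (does (outside ∷ K ≟ˢ J)) * h J))
        (cong₂ _+_ (∑ˢ-zero {n} (λ _ → refl)) (∑ˢ-indicator K (h ∘ (outside ∷_))))

∑ˢ-≡0 : ∀ {n} (h : Subset n → ℕ) → ∑ˢ h ≡ 0 → ∀ J → h J ≡ 0
∑ˢ-≡0 h ∑h≡0 []            = trans (sym (ℕP.+-identityʳ (h []))) ∑h≡0
∑ˢ-≡0 h ∑h≡0 (inside ∷ J)  = ∑ˢ-≡0 _ (ℕP.m+n≡0⇒m≡0 _ (trans (sym (∑ˢ-suc h)) ∑h≡0)) J
∑ˢ-≡0 h ∑h≡0 (outside ∷ J) = ∑ˢ-≡0 _ (ℕP.m+n≡0⇒n≡0 _ (trans (sym (∑ˢ-suc h)) ∑h≡0)) J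

∑ˢ-split : ∀ {n} (j : Fin n) (h : Subset n → ℕ) →
           ∑ˢ h ≡ ∑ˢ (λ J → if lookup J j then 0 else h J + h (J ∪ ⁅ j ⁆))
∑ˢ-split {suc n} zero h = begin
  ∑ˢ h
    ≡⟨ trans (∑ˢ-suc h) (ℕP.+-comm (∑ˢ (h ∘ (inside ∷_))) _) ⟩
  ∑ˢ (h ∘ (outside ∷_)) + ∑ˢ (h ∘ (inside ∷_))
    ≡⟨ sumOver-+ (allSubsets n) (h ∘ (outside ∷_)) (h ∘ (inside ∷_)) ⟨
  ∑ˢ (λ J → h (outside ∷ J) + h (inside ∷ J))
    ≡⟨ sumOver-cong (allSubsets n) (λ J → cong (λ K → h (outside ∷ J) + h (inside ∷ K)) (sym (SubsetP.∪-identityʳ J))) ⟩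
  ∑ˢ (h′ ∘ (outside ∷_))
    ≡⟨ cong (_+ ∑ˢ (h′ ∘ (outside ∷_))) (∑ˢ-zero {n} {h′ ∘ (inside ∷_)} (λ _ → refl)) ⟨
  ∑ˢ (h′ ∘ (inside ∷_)) + ∑ˢ (h′ ∘ (outside ∷_))
    ≡⟨ ∑ˢ-suc h′ ⟨
  ∑ˢ h′ ∎
  where
  open ≡-Reasoning
  h′ : Subset (suc n) → ℕ
  h′ J = if lookup J zero then 0 else h J + h (J ∪ ⁅ zero ⁆)
∑ˢ-split (suc j) h =
  trans (∑ˢ-suc h) (trans (cong₂ _+_ (∑ˢ-split j (h ∘ (inside ∷_))) (∑ˢ-split j (h ∘ (outside ∷_))))
                          (sym (∑ˢ-suc (λ J → if lookup J (suc j) then 0 else h J + h (J ∪ ⁅ suc j ⁆)))))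

sumOver-fibres : ∀ {n} (xs : List A) (f : A → Subset n) (d : Subset n → ℕ) →
                 sumOver xs (λ x → d (f x)) ≡ ∑ˢ (λ J → d J * sumOver xs (λ x → 𝟙 (does (f x ≟ˢ J))))
sumOver-fibres {n = n} xs f d = begin
  sumOver xs (λ x → d (f x))                              ≡⟨ sumOver-cong xs (λ x → sym (∑ˢ-indicator (f x) d)) ⟩
  sumOver xs (λ x → ∑ˢ (λ J → 𝟙 (does (f x ≟ˢ J)) * d J))  ≡⟨ sumOver-comm xs (allSubsets n) _ ⟩
  ∑ˢ (λ J → sumOver xs (λ x → 𝟙 (does (f x ≟ˢ J)) * d J))  ≡⟨ sumOver-cong (allSubsets n) factor ⟩
  ∑ˢ (λ J → d J * sumOver xs (λ x → 𝟙 (does (f x ≟ˢ J))))  ∎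
  where
  open ≡-Reasoning
  factor : ∀ J → sumOver xs (λ x → 𝟙 (does (f x ≟ˢ J)) * d J)
                   ≡ d J * sumOver xs (λ x → 𝟙 (does (f x ≟ˢ J)))
  factor J = trans (sumOver-cong xs (λ x → ℕP.*-comm (𝟙 (does (f x ≟ˢ J))) (d J))) (sumOver-*ˡ xs (d J) _)

-- Colour-preserving injections

sumOver-allFuns-suc : ∀ k n (h : (Fin (suc k) → Fin n) → ℕ) →
                      (∀ f g → (∀ x → f x ≡ g x) → h f ≡ h g) →
                      sumOver (allFuns (suc k) n) h ≡ sumOver (allFuns k n) (λ g → ∑[ x < n ] h (x Vector.∷ g))
sumOver-allFuns-suc k n h h-resp =
  trans (sumOver-concatMap (allFuns k n) _ h)
        (sumOver-cong (allFuns k n) λ g →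
          trans (sumOver-map (allFin n) _ h)
                (trans (sumOver-allFin n _)
                       (sum-cong-≗ λ x → sym (h-resp (x Vector.∷ g) _ λ { zero → refl ; (suc i) → refl }))))

injective? : ∀ {k n} (g : Fin k → Fin n) → Dec (Injective _≡_ _≡_ g)
injective? g = map′ (λ inj {x} {y} → inj x y) (λ inj x y → inj)
                    (FinP.all? λ x → FinP.all? λ y → g x ≟ g y →-dec x ≟ y)

inImage? : ∀ {k n} (g : Fin k → Fin n) x → Dec (∃ λ p → g p ≡ x)
inImage? g x = FinP.any? (λ p → g p ≟ x)

𝟙-inImage : ∀ {k n} (g : Fin k → Fin n) → Injective _≡_ _≡_ g →
            ∀ x → 𝟙 (does (inImage? g x)) ≡ ∑[ p < k ] 𝟙 (does (g p ≟ x))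
𝟙-inImage g inj x with inImage? g x
... | yes (p , gp≡x) = sym (trans (sum-unique _ p others) (cong 𝟙 (dec-true (g p ≟ x) gp≡x)))
  where
  others : ∀ p′ → p′ ≢ p → 𝟙 (does (g p′ ≟ x)) ≡ 0
  others p′ p′≢p = cong 𝟙 (dec-false (g p′ ≟ x) (λ gp′≡x → p′≢p (inj (trans gp′≡x (sym gp≡x)))))
... | no ∄p = sym (sum-zero _ λ p → cong 𝟙 (dec-false (g p ≟ x) (λ gp≡x → ∄p (p , gp≡x))))

∑-image : ∀ {k n} (g : Fin k → Fin n) → Injective _≡_ _≡_ g → (w : Fin n → ℕ) →
          ∑[ x < n ] (w x * 𝟙 (does (inImage? g x))) ≡ ∑[ p < k ] w (g p)
∑-image {k} {n} g inj w = begin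
  ∑[ x < n ] (w x * 𝟙 (does (inImage? g x)))        ≡⟨ sum-cong-≗ (λ x → cong (w x *_) (𝟙-inImage g inj x)) ⟩
  ∑[ x < n ] (w x * ∑[ p < k ] 𝟙 (does (g p ≟ x)))  ≡⟨ sum-cong-≗ (λ x → *-distribˡ-sum (w x) (δ x)) ⟩
  ∑[ x < n ] ∑[ p < k ] (w x * 𝟙 (does (g p ≟ x)))  ≡⟨ ∑-comm (λ x p → w x * δ x p) ⟩
  ∑[ p < k ] ∑[ x < n ] (w x * 𝟙 (does (g p ≟ x)))  ≡⟨ sum-cong-≗ (λ p → sum-unique _ (g p) (off p)) ⟩
  ∑[ p < k ] (w (g p) * 𝟙 (does (g p ≟ g p)))       ≡⟨ sum-cong-≗ on ⟩
  ∑[ p < k ] w (g p)                                ∎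
  where
  open ≡-Reasoning
  δ : Fin n → Fin k → ℕ
  δ x p = 𝟙 (does (g p ≟ x))
  off : ∀ p x → x ≢ g p → w x * 𝟙 (does (g p ≟ x)) ≡ 0
  off p x x≢gp = trans (cong (λ b → w x * 𝟙 b) (dec-false (g p ≟ x) (x≢gp ∘ sym))) (ℕP.*-zeroʳ (w x))
  on : ∀ p → w (g p) * 𝟙 (does (g p ≟ g p)) ≡ w (g p)
  on p = trans (cong (λ b → w (g p) * 𝟙 b) (dec-true (g p ≟ g p) refl)) (ℕP.*-identityʳ (w (g p)))

∑-outsideImage : ∀ {k n} (g : Fin k → Fin n) → Injective _≡_ _≡_ g → (w : Fin n → ℕ) →
                 ∑[ x < n ] (w x * 𝟙 (not (does (inImage? g x)))) ≡ ∑[ x < n ] w x ∸ ∑[ p < k ] w (g p)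
∑-outsideImage {k} {n} g inj w = begin
  missed                    ≡⟨ ℕP.m+n∸n≡m missed hit ⟨
  missed + hit ∸ hit        ≡⟨ cong₂ _∸_ (trans (sym (∑-distrib-+ offImage onImage)) (sum-cong-≗ split)) (∑-image g inj w) ⟩
  ∑[ x < n ] w x ∸ ∑[ p < k ] w (g p) ∎
  where
  open ≡-Reasoning
  offImage onImage  : Fin n → ℕ
  offImage x = w x * 𝟙 (not (does (inImage? g x)))
  onImage   x = w x * 𝟙 (does (inImage? g x))
  missed = sum offImage
  hit    = sum onImage
  split : ∀ x → w x * 𝟙 (not (does (inImage? g x))) + w x * 𝟙 (does (inImage? g x)) ≡ w x
  split x = trans (sym (ℕP.*-distribˡ-+ (w x) _ _))
                  (trans (cong (w x *_) (𝟙-not (does (inImage? g x)))) (ℕP.*-identityʳ (w x)))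

ColouredInjection : ∀ {q k n} → (Fin k → Fin q) → (Fin n → Fin q) → (Fin k → Fin n) → Set
ColouredInjection cp cv g = Injective _≡_ _≡_ g × (∀ p → cv (g p) ≡ cp p)

colouredInjection? : ∀ {q k n} (cp : Fin k → Fin q) (cv : Fin n → Fin q) g → Dec (ColouredInjection cp cv g)
colouredInjection? cp cv g = injective? g ×-dec FinP.all? (λ p → cv (g p) ≟ cp p)

isColouredInjection : ∀ {q k n} → (Fin k → Fin q) → (Fin n → Fin q) → (Fin k → Fin n) → Bool
isColouredInjection cp cv g = does (colouredInjection? cp cv g)

preimageSize : ∀ {q k} → (Fin k → Fin q) → Fin q → ℕ
preimageSize {k = k} f c = ∑[ p < k ] 𝟙 (does (f p ≟ c))

∏ : ∀ {q} → (Fin q → ℕ) → ℕ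
∏ {zero}  f = 1
∏ {suc q} f = f zero * ∏ (f ∘ suc)

∏-1 : ∀ q → ∏ {q} (λ _ → 1) ≡ 1
∏-1 zero    = refl
∏-1 (suc q) = trans (ℕP.+-identityʳ _) (∏-1 q)

∏-scale : ∀ {q} (c : Fin q) (m a : Fin q → ℕ) →
          ∏ (λ d → m d P′ (𝟙 (does (c ≟ d)) + a d)) ≡ (m c ∸ a c) * ∏ (λ d → m d P′ a d)
∏-scale {suc q} zero    m a = ℕP.*-assoc (m zero ∸ a zero) _ _
∏-scale {suc q} (suc c) m a =
  trans (cong ((m zero P′ a zero) *_) (∏-scale c (m ∘ suc) (a ∘ suc)))
        (*-left-comm (m zero P′ a zero) (m (suc c) ∸ a (suc c)) (∏ (λ d → m (suc d) P′ a (suc d))))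

colouredInjection-resp : ∀ {q k n} (cp : Fin k → Fin q) (cv : Fin n → Fin q) {f g} →
                         (∀ x → f x ≡ g x) → ColouredInjection cp cv f → ColouredInjection cp cv g
colouredInjection-resp cp cv f≗g (inj , col) =
  (λ e → inj (trans (f≗g _) (trans e (sym (f≗g _))))) , λ p → trans (cong cv (sym (f≗g p))) (col p)

colouredInjection-∷ : ∀ {q k n} (cp : Fin (suc k) → Fin q) (cv : Fin n → Fin q) x g →
                      ColouredInjection (cp ∘ suc) cv g →
                      ColouredInjection cp cv (x Vector.∷ g) ⇔ (cv x ≡ cp zero × ¬ (∃ λ p → g p ≡ x))
colouredInjection-∷ cp cv x g (inj , col) = mk⇔ to from
  where
  to : ColouredInjection cp cv (x Vector.∷ g) → cv x ≡ cp zero × ¬ (∃ λ p → g p ≡ x)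
  to (inj′ , col′) = col′ zero , λ (p , gp≡x) → case inj′ {suc p} {zero} gp≡x of λ ()
  from : cv x ≡ cp zero × ¬ (∃ λ p → g p ≡ x) → ColouredInjection cp cv (x Vector.∷ g)
  from (cx , x∉g) = inj′ , λ { zero → cx ; (suc p) → col p }
    where
    inj′ : Injective _≡_ _≡_ (x Vector.∷ g)
    inj′ {zero}  {zero}  _    = refl
    inj′ {zero}  {suc p} x≡gp = ⊥-elim (x∉g (p , sym x≡gp))
    inj′ {suc p} {zero}  gp≡x = ⊥-elim (x∉g (p , gp≡x))
    inj′ {suc p} {suc p′} e   = cong suc (inj e)

colouredInjection-∷⁻ : ∀ {q k n} (cp : Fin (suc k) → Fin q) (cv : Fin n → Fin q) x g →
                       ColouredInjection cp cv (x Vector.∷ g) → ColouredInjection (cp ∘ suc) cv g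
colouredInjection-∷⁻ cp cv x g (inj , col) = (λ e → FinP.suc-injective (inj e)) , col ∘ suc

∑-extend-injection : ∀ {q k n} (cp : Fin (suc k) → Fin q) (cv : Fin n → Fin q) g →
                     ColouredInjection (cp ∘ suc) cv g →
                     ∑[ x < n ] 𝟙 (isColouredInjection cp cv (x Vector.∷ g))
                       ≡ preimageSize cv (cp zero) ∸ preimageSize (cp ∘ suc) (cp zero)
∑-extend-injection {n = n} cp cv g ci@(inj , col) = begin
  ∑[ x < n ] 𝟙 (isColouredInjection cp cv (x Vector.∷ g))  ≡⟨ sum-cong-≗ step ⟩
  ∑[ x < n ] (w x * 𝟙 (not (does (inImage? g x))))      ≡⟨ ∑-outsideImage g inj w ⟩
  preimageSize cv c ∸ ∑[ p < _ ] w (g p)                 ≡⟨ cong (preimageSize cv c ∸_) (sum-cong-≗ (cong w′ ∘ col)) ⟩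
  preimageSize cv c ∸ preimageSize (cp ∘ suc) c          ∎
  where
  open ≡-Reasoning
  c = cp zero
  w′ : _ → ℕ
  w′ d = 𝟙 (does (d ≟ c))
  w : Fin n → ℕ
  w x = w′ (cv x)
  step : ∀ x → 𝟙 (isColouredInjection cp cv (x Vector.∷ g)) ≡ w x * 𝟙 (not (does (inImage? g x)))
  step x = trans (cong 𝟙 (does-⇔ (colouredInjection-∷ cp cv x g ci)
                                 (colouredInjection? cp cv (x Vector.∷ g)) ((cv x ≟ c) ×-dec ¬? (inImage? g x))))
                 (𝟙-∧ (does (cv x ≟ c)) _)

∑-extend : ∀ {q k n} (cp : Fin (suc k) → Fin q) (cv : Fin n → Fin q) g →
           ∑[ x < n ] 𝟙 (isColouredInjection cp cv (x Vector.∷ g))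
             ≡ (preimageSize cv (cp zero) ∸ preimageSize (cp ∘ suc) (cp zero))
                 * 𝟙 (isColouredInjection (cp ∘ suc) cv g)
∑-extend {n = n} cp cv g with colouredInjection? (cp ∘ suc) cv g
... | yes ci = trans (∑-extend-injection cp cv g ci)
                     (sym (trans (cong (λ b → δ * 𝟙 b) (dec-true (colouredInjection? (cp ∘ suc) cv g) ci))
                                 (ℕP.*-identityʳ δ)))
  where δ = preimageSize cv (cp zero) ∸ preimageSize (cp ∘ suc) (cp zero)
... | no ¬ci = trans (sum-zero _ λ x → cong 𝟙 (dec-false (colouredInjection? cp cv (x Vector.∷ g))
                                                          (¬ci ∘ colouredInjection-∷⁻ cp cv x g)))
                     (sym (trans (cong (λ b → δ * 𝟙 b) (dec-false (colouredInjection? (cp ∘ suc) cv g) ¬ci))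
                                 (ℕP.*-zeroʳ δ)))
  where δ = preimageSize cv (cp zero) ∸ preimageSize (cp ∘ suc) (cp zero)

#colouredInjections : ∀ {q} k n (cp : Fin k → Fin q) (cv : Fin n → Fin q) →
                      sumOver (allFuns k n) (λ g → 𝟙 (isColouredInjection cp cv g))
                        ≡ ∏ (λ c → preimageSize cv c P′ preimageSize cp c)
#colouredInjections {q} zero n cp cv =
  trans (cong (λ b → 𝟙 b + 0) (dec-true (colouredInjection? cp cv (λ ())) ((λ { {()} }) , λ ())))
        (sym (∏-1 q))
#colouredInjections (suc k) n cp cv = begin
  sumOver (allFuns (suc k) n) (λ g → 𝟙 (isColouredInjection cp cv g))
    ≡⟨ sumOver-allFuns-suc k n _ 𝟙-resp ⟩
  sumOver (allFuns k n) (λ g → ∑[ x < n ] 𝟙 (isColouredInjection cp cv (x Vector.∷ g)))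
    ≡⟨ sumOver-cong (allFuns k n) (∑-extend cp cv) ⟩
  sumOver (allFuns k n) (λ g → (m c ∸ a′ c) * 𝟙 (isColouredInjection (cp ∘ suc) cv g))
    ≡⟨ sumOver-*ˡ (allFuns k n) (m c ∸ a′ c) _ ⟩
  (m c ∸ a′ c) * sumOver (allFuns k n) (λ g → 𝟙 (isColouredInjection (cp ∘ suc) cv g))
    ≡⟨ cong ((m c ∸ a′ c) *_) (#colouredInjections k n (cp ∘ suc) cv) ⟩
  (m c ∸ a′ c) * ∏ (λ d → m d P′ a′ d)
    ≡⟨ ∏-scale c m a′ ⟨
  ∏ (λ d → m d P′ preimageSize cp d) ∎
  where
  open ≡-Reasoning
  m = preimageSize cv
  a′ = preimageSize (cp ∘ suc)
  c = cp zero
  𝟙-resp : ∀ f g → (∀ x → f x ≡ g x) → 𝟙 (isColouredInjection cp cv f) ≡ 𝟙 (isColouredInjection cp cv g)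
  𝟙-resp f g f≗g = cong 𝟙 (does-⇔ (mk⇔ (colouredInjection-resp cp cv f≗g) (colouredInjection-resp cp cv (sym ∘ f≗g)))
                                  (colouredInjection? cp cv f) (colouredInjection? cp cv g))

-- Orders with a prescribed set of later blocks

∧≡true : ∀ {a b} → a ∧ b ≡ true → a ≡ true × b ≡ true
∧≡true {true} {true} _ = refl , refl

does≡true⇒ : ∀ {P : Set} (P? : Dec P) → does P? ≡ true → P
does≡true⇒ (yes p) _ = p

T-does : ∀ {P : Set} (P? : Dec P) → T (does P?) ⇔ P
T-does (yes p) = mk⇔ (λ _ → p) (λ _ → _)
T-does (no ¬p) = mk⇔ (λ ()) ¬p

T-and : ∀ bs → T (BoolList.and bs) ⇔ All.All T bs
T-and []       = mk⇔ (λ _ → All.[]) (λ _ → _)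
T-and (b ∷ bs) = mk⇔ (λ t → proj₁ (split t) All.∷ Equivalence.to (T-and bs) (proj₂ (split t)))
                     (λ { (tb All.∷ tbs) → Equivalence.from BoolP.T-∧ (tb , Equivalence.from (T-and bs) tbs) })
  where split = Equivalence.to (BoolP.T-∧ {b})

-- isInjective f is, definitionally, the conjunction of does (f i ≟ f j →-dec i ≟ j) over all pairs i, j.
T-isInjective : ∀ {n} (f : Fin n → Fin n) → T (isInjective f) ⇔ Injective _≡_ _≡_ f
T-isInjective {n} f = mk⇔ to from
  where
  to : T (isInjective f) → Injective _≡_ _≡_ f
  to t {i} {j} = Equivalence.to (T-does (f i ≟ f j →-dec i ≟ j))
    (All.lookup (AllP.map⁻ (All.lookup (AllP.map⁻ (AllP.concat⁻ (Equivalence.to (T-and _) t)))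
                                       (∈ListP.∈-allFin i)))
                (∈ListP.∈-allFin j))
  from : Injective _≡_ _≡_ f → T (isInjective f)
  from inj = Equivalence.from (T-and _)
    (AllP.concat⁺ (AllP.map⁺ (AllP.tabulate⁺ λ i →
      AllP.map⁺ (AllP.tabulate⁺ λ j → Equivalence.from (T-does (f i ≟ f j →-dec i ≟ j)) inj))))

sumOver-permutations : ∀ n (h : (Fin n → Fin n) → ℕ) →
                       sumOver (permutations n) h ≡ sumOver (allFuns n n) (λ π → 𝟙 (does (injective? π)) * h π)
sumOver-permutations n h =
  trans (sumOver-filter (λ f → isInjective f Bool.≟ true) (allFuns n n) h)
        (sumOver-cong (allFuns n n) λ π →
          cong (λ b → 𝟙 b * h π)
               (does-⇔ (T-isInjective π ⇔-∘ ⇔-sym BoolP.T-≡) (isInjective π Bool.≟ true) (injective? π)))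

side : Bool → Fin 3
side b = if b then 2F else 0F

side-injective : ∀ {b c} → side b ≡ side c → b ≡ c
side-injective {true}  {true}  _ = refl
side-injective {false} {false} _ = refl

-- 1F marks the pivot, 2F the elements after it and 0F the elements before it.
colouring : ∀ {m} (pivot : Fin m) (after : Fin m → Bool) → Fin m → Fin 3
colouring pivot after x = if does (x ≟ pivot) then 1F else side (after x)

colouring-pivot : ∀ {m} (pivot : Fin m) after → colouring pivot after pivot ≡ 1F
colouring-pivot pivot after = cong (λ b → if b then 1F else side (after pivot)) (dec-true (pivot ≟ pivot) refl)

colouring-other : ∀ {m} {pivot x : Fin m} after → x ≢ pivot → colouring pivot after x ≡ side (after x)
colouring-other {pivot = pivot} {x} after x≢pivot =
  cong (λ b → if b then 1F else side (after x)) (dec-false (x ≟ pivot) x≢pivot)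

colouring≡1F : ∀ {m} {pivot x : Fin m} after → colouring pivot after x ≡ 1F → x ≡ pivot
colouring≡1F {pivot = pivot} {x} after c≡1 with x ≟ pivot | after x
... | yes x≡pivot | _     = x≡pivot
... | no _        | true  = case c≡1 of λ ()
... | no _        | false = case c≡1 of λ ()

preimageSize-pivot : ∀ {m} (pivot : Fin m) after → preimageSize (colouring pivot after) 1F ≡ 1
preimageSize-pivot pivot after =
  trans (sum-unique _ pivot λ x x≢pivot → trans (cong is-1F (colouring-other after x≢pivot)) (off (after x)))
        (cong is-1F (colouring-pivot pivot after))
  where
  is-1F : Fin 3 → ℕ
  is-1F c = 𝟙 (does (c ≟ 1F))
  off : ∀ b → 𝟙 (does (side b ≟ 1F)) ≡ 0
  off true  = refl
  off false = refl

preimageSize-after : ∀ {m} (pivot : Fin m) after → after pivot ≡ false →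
                     preimageSize (colouring pivot after) 2F ≡ ∑[ x < m ] 𝟙 (after x)
preimageSize-after pivot after after-pivot = sum-cong-≗ pointwise
  where
  on-side : ∀ b → 𝟙 (does (side b ≟ 2F)) ≡ 𝟙 b
  on-side true  = refl
  on-side false = refl
  pointwise : ∀ x → 𝟙 (does (colouring pivot after x ≟ 2F)) ≡ 𝟙 (after x)
  pointwise x with x ≟ pivot
  ... | yes refl = cong 𝟙 (sym after-pivot)
  ... | no _     = on-side (after x)

∑-preimageSize : ∀ {q k} (f : Fin k → Fin q) → ∑[ c < q ] preimageSize f c ≡ k
∑-preimageSize {q} {k} f = begin
  ∑[ c < q ] ∑[ p < k ] 𝟙 (does (f p ≟ c))  ≡⟨ ∑-comm (λ c p → 𝟙 (does (f p ≟ c))) ⟩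
  ∑[ p < k ] ∑[ c < q ] 𝟙 (does (f p ≟ c))  ≡⟨ sum-cong-≗ (λ p → trans (sum-unique _ (f p) (off p)) (on p)) ⟩
  ∑[ p < k ] 1                              ≡⟨ sum-const-1 k ⟩
  k                                         ∎
  where
  open ≡-Reasoning
  off : ∀ p c → c ≢ f p → 𝟙 (does (f p ≟ c)) ≡ 0
  off p c c≢fp = cong 𝟙 (dec-false (f p ≟ c) (c≢fp ∘ sym))
  on : ∀ p → 𝟙 (does (f p ≟ f p)) ≡ 1
  on p = cong 𝟙 (dec-true (f p ≟ f p) refl)

colouring-total : ∀ {m} (pivot : Fin m) after →
                  preimageSize (colouring pivot after) 0F + suc (preimageSize (colouring pivot after) 2F) ≡ m
colouring-total {m} pivot after = begin
  c₀ + suc c₂              ≡⟨ cong (λ v → c₀ + suc v) (ℕP.+-identityʳ c₂) ⟨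
  c₀ + (1 + (c₂ + 0))      ≡⟨ cong (λ u → c₀ + (u + (c₂ + 0))) (preimageSize-pivot pivot after) ⟨
  c₀ + (c₁ + (c₂ + 0))     ≡⟨ ∑-preimageSize (colouring pivot after) ⟩
  m                        ∎
  where
  open ≡-Reasoning
  c₀ = preimageSize (colouring pivot after) 0F
  c₁ = preimageSize (colouring pivot after) 1F
  c₂ = preimageSize (colouring pivot after) 2F

<ᵇ-irrefl : ∀ t → (t <ᵇ t) ≡ false
<ᵇ-irrefl zero    = refl
<ᵇ-irrefl (suc t) = <ᵇ-irrefl t

∑-<ᵇ : ∀ n t → ∑[ x < n ] 𝟙 (t <ᵇ toℕ x) ≡ n ∸ suc t
∑-<ᵇ zero    t       = refl
∑-<ᵇ (suc n) zero    = sum-const-1 n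
∑-<ᵇ (suc n) (suc t) = ∑-<ᵇ n t

∣∣≡∑lookup : ∀ {n} (J : Subset n) → ∣ J ∣ ≡ ∑[ x < n ] 𝟙 (lookup J x)
∣∣≡∑lookup []            = refl
∣∣≡∑lookup (inside ∷ J)  = cong suc (∣∣≡∑lookup J)
∣∣≡∑lookup (outside ∷ J) = ∣∣≡∑lookup J

≤ᵇ≡<ᵇ : ∀ {m n} → m ≢ n → (m ≤ᵇ n) ≡ (m <ᵇ n)
≤ᵇ≡<ᵇ {zero}  {zero}  m≢n = contradiction refl m≢n
≤ᵇ≡<ᵇ {zero}  {suc n} _   = refl
≤ᵇ≡<ᵇ {suc m} {zero}  _   = refl
≤ᵇ≡<ᵇ {suc m} {suc n} m≢n = trans (<ᵇ-suc m) (≤ᵇ≡<ᵇ (m≢n ∘ cong suc))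
  where
  <ᵇ-suc : ∀ m → (m <ᵇ suc n) ≡ (m ≤ᵇ n)
  <ᵇ-suc zero    = refl
  <ᵇ-suc (suc m) = refl

lookup-ext : ∀ {n} {u v : Vec A n} → (∀ p → lookup u p ≡ lookup v p) → u ≡ v
lookup-ext {u = u} {v} u≗v =
  trans (sym (VecP.tabulate∘lookup u)) (trans (VecP.tabulate-cong u≗v) (VecP.tabulate∘lookup v))

∉⇒lookup≡false : ∀ {n} {x : Fin n} {J : Subset n} → x ∉ J → lookup J x ≡ false
∉⇒lookup≡false {x = x} {J} x∉J with lookup J x in eq
... | true  = contradiction (VecP.lookup⇒[]= x J eq) x∉J
... | false = refl

-- The same vector as geqMinus, without the game parameters of that definition.
later : ∀ {n} → (Fin n → Fin n) → Fin n → Subset n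
later π i = tabulate (λ j → (toℕ (π i) ≤ᵇ toℕ (π j)) ∧ not (does (j ≟ i)))

positionColouring : ∀ {n} → Fin n → Fin n → Fin 3
positionColouring r = colouring r (λ x → toℕ r <ᵇ toℕ x)

playerColouring : ∀ {n} → Fin n → Subset n → Fin n → Fin 3
playerColouring i J = colouring i (lookup J)

later≡⇔coloured : ∀ {n} (π : Fin n → Fin n) {i J} → Injective _≡_ _≡_ π → i ∉ J →
                  later π i ≡ J ⇔ (∀ p → positionColouring (π i) (π p) ≡ playerColouring i J p)
later≡⇔coloured π {i} {J} inj i∉J =
  mk⇔ (λ eq p → Equivalence.to (pointwise p) (cong (λ v → lookup v p) eq))
      (λ col → lookup-ext (λ p → Equivalence.from (pointwise p) (col p)))
  where
  lookup-later : ∀ p → lookup (later π i) p ≡ (toℕ (π i) ≤ᵇ toℕ (π p)) ∧ not (does (p ≟ i))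
  lookup-later p = VecP.lookup∘tabulate _ p
  after : Fin _ → Bool
  after x = toℕ (π i) <ᵇ toℕ x
  pointwise : ∀ p → (lookup (later π i) p ≡ lookup J p) ⇔ (positionColouring (π i) (π p) ≡ playerColouring i J p)
  pointwise p with p ≟ i
  ... | yes refl =
    mk⇔ (λ _ → colouring-pivot (π p) after)
        (λ _ → trans (lookup-later p)
                     (trans (cong (λ b → (toℕ (π p) ≤ᵇ toℕ (π p)) ∧ not b) (dec-true (p ≟ p) refl))
                            (trans (BoolP.∧-zeroʳ _) (sym (∉⇒lookup≡false i∉J)))))
  ... | no p≢i =
    mk⇔ (λ e → trans (colouring-other after πp≢πi) (cong side (trans (sym later-p) e)))
        (λ e → trans later-p (side-injective (trans (sym (colouring-other after πp≢πi)) e)))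
    where
    πp≢πi : π p ≢ π i
    πp≢πi = p≢i ∘ inj
    later-p : lookup (later π i) p ≡ after (π p)
    later-p = trans (lookup-later p)
                    (trans (cong (λ b → (toℕ (π i) ≤ᵇ toℕ (π p)) ∧ not b) (dec-false (p ≟ i) p≢i))
                           (trans (BoolP.∧-identityʳ _) (≤ᵇ≡<ᵇ (πp≢πi ∘ sym ∘ FinP.toℕ-injective))))

𝟙-later≡ : ∀ {n} (π : Fin n → Fin n) (i : Fin n) (J : Subset n) → i ∉ J →
           𝟙 (does (injective? π)) * 𝟙 (does (later π i ≟ˢ J))
             ≡ ∑[ r < n ] 𝟙 (isColouredInjection (playerColouring i J) (positionColouring r) π)
𝟙-later≡ {n} π i J i∉J with injective? π
... | no ¬inj = begin
  𝟙 (does (injective? π)) * 𝟙 (does (later π i ≟ˢ J))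
    ≡⟨ cong (λ b → 𝟙 b * 𝟙 (does (later π i ≟ˢ J))) (dec-false (injective? π) ¬inj) ⟩
  0
    ≡⟨ sum-zero _ (λ r → cong 𝟙 (dec-false (ci? r) (¬inj ∘ proj₁))) ⟨
  ∑[ r < n ] 𝟙 (does (ci? r)) ∎
  where
  open ≡-Reasoning
  ci? : ∀ r → Dec (ColouredInjection (playerColouring i J) (positionColouring r) π)
  ci? r = colouredInjection? (playerColouring i J) (positionColouring r) π
... | yes inj = begin
  𝟙 (does (injective? π)) * 𝟙 (does (later π i ≟ˢ J))
    ≡⟨ cong (λ b → 𝟙 b * 𝟙 (does (later π i ≟ˢ J))) (dec-true (injective? π) inj) ⟩
  1 * 𝟙 (does (later π i ≟ˢ J))
    ≡⟨ ℕP.*-identityˡ _ ⟩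
  𝟙 (does (later π i ≟ˢ J))
    ≡⟨ cong 𝟙 (does-⇔ later≡⇔ci (later π i ≟ˢ J) (ci? (π i))) ⟩
  𝟙 (does (ci? (π i)))
    ≡⟨ sum-unique (λ r → 𝟙 (does (ci? r))) (π i) others ⟨
  ∑[ r < n ] 𝟙 (does (ci? r)) ∎
  where
  open ≡-Reasoning
  ci? : ∀ r → Dec (ColouredInjection (playerColouring i J) (positionColouring r) π)
  ci? r = colouredInjection? (playerColouring i J) (positionColouring r) π
  later≡⇔ci : later π i ≡ J ⇔ ColouredInjection (playerColouring i J) (positionColouring (π i)) π
  later≡⇔ci = mk⇔ (λ eq → (λ {x} {y} → inj {x} {y}) , Equivalence.to (later≡⇔coloured π inj i∉J) eq)
                  (λ ci → Equivalence.from (later≡⇔coloured π inj i∉J) (proj₂ ci))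
  others : ∀ r → r ≢ π i → 𝟙 (does (ci? r)) ≡ 0
  others r r≢πi = cong 𝟙 (dec-false (ci? r) λ (_ , col) →
    r≢πi (sym (colouring≡1F (λ x → toℕ r <ᵇ toℕ x) (trans (col i) (colouring-pivot i (lookup J))))))

shapleyWeight : ℕ → ℕ → ℕ
shapleyWeight p a = a ! * (p ∸ a ∸ 1) !

P′-zero : ∀ {m k} → m < k → m P′ k ≡ 0
P′-zero {m} {suc k} (s≤s m≤k) with ℕP.m≤n⇒m<n∨m≡n m≤k
... | inj₁ m<k  = trans (cong ((m ∸ k) *_) (P′-zero m<k)) (ℕP.*-zeroʳ (m ∸ k))
... | inj₂ refl = cong (_* (m P′ m)) (ℕP.n∸n≡0 m)

∑-fallingFactorials : ∀ n a b → a + suc b ≡ n →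
                      ∑[ r < n ] ((toℕ r P′ a) * ((n ∸ suc (toℕ r)) P′ b)) ≡ a ! * b !
∑-fallingFactorials n a b a+1+b≡n =
  trans (sum-unique _ r₀ others)
        (cong₂ _*_ (trans (cong (_P′ a) r₀≡a) (nP′n≡n! a))
                   (trans (cong (λ r → (n ∸ suc r) P′ b) r₀≡a) (trans (cong (_P′ b) n∸1+a≡b) (nP′n≡n! b))))
  where
  a<n : a < n
  a<n = subst (a <_) a+1+b≡n (ℕP.m<m+n a (s≤s z≤n))
  r₀ : Fin n
  r₀ = fromℕ< a<n
  r₀≡a : toℕ r₀ ≡ a
  r₀≡a = FinP.toℕ-fromℕ< a<n
  n∸1+a≡b : n ∸ suc a ≡ b
  n∸1+a≡b = trans (cong (_∸ suc a) (trans (sym a+1+b≡n) (ℕP.+-suc a b))) (ℕP.m+n∸m≡n (suc a) b)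
  others : ∀ r → r ≢ r₀ → (toℕ r P′ a) * ((n ∸ suc (toℕ r)) P′ b) ≡ 0
  others r r≢r₀ with ℕP.<-cmp (toℕ r) a
  ... | tri< r<a _ _ = cong (_* ((n ∸ suc (toℕ r)) P′ b)) (P′-zero r<a)
  ... | tri≈ _ r≡a _ = contradiction (FinP.toℕ-injective (trans r≡a (sym r₀≡a))) r≢r₀
  ... | tri> _ _ a<r = trans (cong ((toℕ r P′ a) *_) (P′-zero tail<b)) (ℕP.*-zeroʳ (toℕ r P′ a))
    where
    tail<b : n ∸ suc (toℕ r) < b
    tail<b = ℕP.+-cancelʳ-< (suc (toℕ r)) _ _ (begin-strict
      n ∸ suc (toℕ r) + suc (toℕ r) ≡⟨ ℕP.m∸n+n≡m (FinP.toℕ<n r) ⟩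
      n                             ≡⟨ a+1+b≡n ⟨
      a + suc b                     ≡⟨ ℕP.+-comm a (suc b) ⟩
      suc b + a                     <⟨ ℕP.+-monoʳ-< (suc b) a<r ⟩
      suc b + toℕ r                 ≡⟨ ℕP.+-suc b (toℕ r) ⟨
      b + suc (toℕ r)               ∎)
      where open ℕP.≤-Reasoning

∏-colourings : ∀ {n} (i r : Fin n) (J : Subset n) → i ∉ J →
               ∏ (λ c → preimageSize (positionColouring r) c P′ preimageSize (playerColouring i J) c)
                 ≡ (toℕ r P′ preimageSize (playerColouring i J) 0F) * ((n ∸ suc (toℕ r)) P′ ∣ J ∣)
∏-colourings {n} i r J i∉J =
  cong₂ _*_ (cong (_P′ a 0F) m₀)
            (trans (cong₂ (λ u v → (u P′ v) * ((m 2F P′ a 2F) * 1)) (preimageSize-pivot r _) (preimageSize-pivot i _))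
                   (trans (ℕP.+-identityʳ _) (trans (ℕP.*-identityʳ _) (cong₂ _P′_ m₂ a₂))))
  where
  open ≡-Reasoning
  a m : Fin 3 → ℕ
  a = preimageSize (playerColouring i J)
  m = preimageSize (positionColouring r)
  a₂ : a 2F ≡ ∣ J ∣
  a₂ = trans (preimageSize-after i (lookup J) (∉⇒lookup≡false i∉J)) (sym (∣∣≡∑lookup J))
  m₂ : m 2F ≡ n ∸ suc (toℕ r)
  m₂ = trans (preimageSize-after r _ (<ᵇ-irrefl (toℕ r))) (∑-<ᵇ n (toℕ r))
  m₀ : m 0F ≡ toℕ r
  m₀ = ℕP.+-cancelʳ-≡ (suc (n ∸ suc (toℕ r))) _ _ (begin
    m 0F + suc (n ∸ suc (toℕ r))    ≡⟨ cong (λ v → m 0F + suc v) m₂ ⟨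
    m 0F + suc (m 2F)               ≡⟨ colouring-total r _ ⟩
    n                               ≡⟨ ℕP.m+[n∸m]≡n (FinP.toℕ<n r) ⟨
    suc (toℕ r) + (n ∸ suc (toℕ r)) ≡⟨ ℕP.+-suc (toℕ r) _ ⟨
    toℕ r + suc (n ∸ suc (toℕ r))   ∎)

#permutationsWithLater : ∀ {n} (i : Fin n) (J : Subset n) → i ∉ J →
                         sumOver (permutations n) (λ π → 𝟙 (does (later π i ≟ˢ J))) ≡ shapleyWeight n ∣ J ∣
#permutationsWithLater {n} i J i∉J = begin
  sumOver (permutations n) (λ π → 𝟙 (does (later π i ≟ˢ J)))
    ≡⟨ sumOver-permutations n _ ⟩
  sumOver (allFuns n n) (λ π → 𝟙 (does (injective? π)) * 𝟙 (does (later π i ≟ˢ J)))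
    ≡⟨ sumOver-cong (allFuns n n) (λ π → 𝟙-later≡ π i J i∉J) ⟩
  sumOver (allFuns n n) (λ π → ∑[ r < n ] 𝟙 (isColouredInjection (playerColouring i J) (positionColouring r) π))
    ≡⟨ sumOver-comm-∑ (allFuns n n) n _ ⟩
  ∑[ r < n ] sumOver (allFuns n n) (λ π → 𝟙 (isColouredInjection (playerColouring i J) (positionColouring r) π))
    ≡⟨ sum-cong-≗ (λ r → trans (#colouredInjections n n (playerColouring i J) (positionColouring r))
                               (∏-colourings i r J i∉J)) ⟩
  ∑[ r < n ] ((toℕ r P′ a₀) * ((n ∸ suc (toℕ r)) P′ ∣ J ∣))
    ≡⟨ ∑-fallingFactorials n a₀ ∣ J ∣ total ⟩
  a₀ ! * ∣ J ∣ !
    ≡⟨ ℕP.*-comm (a₀ !) (∣ J ∣ !) ⟩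
  ∣ J ∣ ! * a₀ !
    ≡⟨ cong (λ x → ∣ J ∣ ! * x !) a₀≡ ⟩
  shapleyWeight n ∣ J ∣ ∎
  where
  open ≡-Reasoning
  a₀ = preimageSize (playerColouring i J) 0F
  total : a₀ + suc ∣ J ∣ ≡ n
  total = trans (cong (λ v → a₀ + suc v)
                      (trans (∣∣≡∑lookup J) (sym (preimageSize-after i (lookup J) (∉⇒lookup≡false i∉J)))))
                (colouring-total i (lookup J))
  a₀≡ : a₀ ≡ n ∸ ∣ J ∣ ∸ 1
  a₀≡ = sym (begin
    n ∸ ∣ J ∣ ∸ 1                ≡⟨ ℕP.∸-+-assoc n ∣ J ∣ 1 ⟩
    n ∸ (∣ J ∣ + 1)              ≡⟨ cong (n ∸_) (ℕP.+-comm ∣ J ∣ 1) ⟩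
    n ∸ suc ∣ J ∣                ≡⟨ cong (_∸ suc ∣ J ∣) total ⟨
    a₀ + suc ∣ J ∣ ∸ suc ∣ J ∣   ≡⟨ ℕP.m+n∸n≡m a₀ (suc ∣ J ∣) ⟩
    a₀                           ∎)

∪-⁅⁆-absorb : ∀ {n} {x : Fin n} {p : Subset n} → x ∈ p → p ∪ ⁅ x ⁆ ≡ p
∪-⁅⁆-absorb {x = x} {p} x∈p = SubsetP.⊆-antisym p∪x⊆p (SubsetP.p⊆p∪q ⁅ x ⁆)
  where
  p∪x⊆p : p ∪ ⁅ x ⁆ ⊆ p
  p∪x⊆p y∈ with SubsetP.x∈p∪q⁻ p ⁅ x ⁆ y∈
  ... | inj₁ y∈p  = y∈p
  ... | inj₂ y∈⁅x⁆ rewrite SubsetP.x∈⁅y⁆⇒x≡y x y∈⁅x⁆ = x∈p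

⊆-∪⁅⁆⇔ : ∀ {n} {x : Fin n} {J P : Subset n} → x ∉ J → (J ⊆ P ∪ ⁅ x ⁆) ⇔ (J ⊆ P)
⊆-∪⁅⁆⇔ {x = x} {J} {P} x∉J = mk⇔ drop-x add-x
  where
  add-x : J ⊆ P → J ⊆ P ∪ ⁅ x ⁆
  add-x J⊆P y∈J = SubsetP.p⊆p∪q ⁅ x ⁆ (J⊆P y∈J)
  drop-x : J ⊆ P ∪ ⁅ x ⁆ → J ⊆ P
  drop-x J⊆P∪x y∈J with SubsetP.x∈p∪q⁻ P ⁅ x ⁆ (J⊆P∪x y∈J)
  ... | inj₁ y∈P   = y∈P
  ... | inj₂ y∈⁅x⁆ = contradiction (subst (_∈ J) (SubsetP.x∈⁅y⁆⇒x≡y x y∈⁅x⁆) y∈J) x∉J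

∪⁅⁆-⊆-∪⁅⁆⇔ : ∀ {n} {x : Fin n} {J P : Subset n} → x ∉ J → (J ∪ ⁅ x ⁆ ⊆ P ∪ ⁅ x ⁆) ⇔ (J ⊆ P)
∪⁅⁆-⊆-∪⁅⁆⇔ {x = x} {J} {P} x∉J =
  mk⇔ drop-x mono
  where
  drop-x : J ∪ ⁅ x ⁆ ⊆ P ∪ ⁅ x ⁆ → J ⊆ P
  drop-x J∪x⊆P∪x = Equivalence.to (⊆-∪⁅⁆⇔ x∉J) (λ y∈J → J∪x⊆P∪x (SubsetP.p⊆p∪q ⁅ x ⁆ y∈J))
  mono : J ⊆ P → J ∪ ⁅ x ⁆ ⊆ P ∪ ⁅ x ⁆
  mono J⊆P y∈J∪x with SubsetP.x∈p∪q⁻ J ⁅ x ⁆ y∈J∪x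
  ... | inj₁ y∈J   = SubsetP.p⊆p∪q ⁅ x ⁆ (J⊆P y∈J)
  ... | inj₂ y∈⁅x⁆ = SubsetP.q⊆p∪q P ⁅ x ⁆ y∈⁅x⁆

∣∪⁅⁆∣ : ∀ {n} {x : Fin n} {p : Subset n} → x ∉ p → ∣ p ∪ ⁅ x ⁆ ∣ ≡ suc ∣ p ∣
∣∪⁅⁆∣ {x = zero}  {inside  ∷ p} x∉p = contradiction here x∉p
∣∪⁅⁆∣ {x = zero}  {outside ∷ p} x∉p = cong (suc ∘ ∣_∣) (SubsetP.∪-identityʳ p)
∣∪⁅⁆∣ {x = suc x} {inside  ∷ p} x∉p = cong suc (∣∪⁅⁆∣ (x∉p ∘ there))
∣∪⁅⁆∣ {x = suc x} {outside ∷ p} x∉p = ∣∪⁅⁆∣ (x∉p ∘ there)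

shapleyWeight-step : ∀ {p a} → suc a ≤ p →
                     shapleyWeight (suc p) a + shapleyWeight (suc p) (suc a) ≡ suc p * shapleyWeight p a
shapleyWeight-step {p} {a} 1+a≤p =
  subst (λ p → shapleyWeight (suc p) a + shapleyWeight (suc p) (suc a) ≡ suc p * shapleyWeight p a) a+1+e≡p (begin
    a ! * (suc (a + suc e) ∸ a ∸ 1) ! + suc a ! * (a + suc e ∸ a ∸ 1) !
      ≡⟨ cong₂ (λ x y → a ! * x ! + suc a ! * y !)
               (trans (cong (λ z → z ∸ a ∸ 1) (sym (ℕP.+-suc a (suc e)))) (∸-cancel a (suc e))) (∸-cancel a e) ⟩
    a ! * suc e ! + suc a ! * e !
      ≡⟨ weight-identity a e (a !) (e !) ⟩
    suc (a + suc e) * (a ! * e !)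
      ≡⟨ cong (λ x → suc (a + suc e) * (a ! * x !)) (∸-cancel a e) ⟨
    suc (a + suc e) * (a ! * (a + suc e ∸ a ∸ 1) !) ∎)
  where
  open ≡-Reasoning
  e = proj₁ (ℕP.m≤n⇒∃[o]m+o≡n 1+a≤p)
  a+1+e≡p : a + suc e ≡ p
  a+1+e≡p = trans (ℕP.+-suc a e) (proj₂ (ℕP.m≤n⇒∃[o]m+o≡n 1+a≤p))
  ∸-cancel : ∀ a e → a + suc e ∸ a ∸ 1 ≡ e
  ∸-cancel a e = cong (_∸ 1) (ℕP.m+n∸m≡n a (suc e))
  weight-identity : ∀ a e A E → A * (suc e * E) + suc a * A * E ≡ suc (a + suc e) * (A * E)
  weight-identity = solve-∀

𝟙*shapleyWeight-step : ∀ b {p a} → (b ≡ true → suc a ≤ p) →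
                       𝟙 b * shapleyWeight (suc p) a + 𝟙 b * shapleyWeight (suc p) (suc a)
                         ≡ suc p * (𝟙 b * shapleyWeight p a)
𝟙*shapleyWeight-step true  {p} {a} bound =
  trans (cong₂ _+_ (ℕP.*-identityˡ (shapleyWeight (suc p) a)) (ℕP.*-identityˡ (shapleyWeight (suc p) (suc a))))
        (trans (shapleyWeight-step (bound refl)) (cong (suc p *_) (sym (ℕP.*-identityˡ (shapleyWeight p a)))))
𝟙*shapleyWeight-step false {p} _ = sym (ℕP.*-zeroʳ (suc p))

ℕ/1-+ : ∀ a b → ℤ.+ a / 1 ℚ.+ ℤ.+ b / 1 ≡ ℤ.+ (a + b) / 1
ℕ/1-+ a b = ℚP.toℚᵘ-injective (begin
  toℚᵘ (ℤ.+ a / 1 ℚ.+ ℤ.+ b / 1)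
    ≈⟨ ℚP.toℚᵘ-homo-+ (ℤ.+ a / 1) (ℤ.+ b / 1) ⟩
  toℚᵘ (ℤ.+ a / 1) ℚᵘ.+ toℚᵘ (ℤ.+ b / 1)
    ≈⟨ ℚᵘP.+-cong (ℚP.toℚᵘ-fromℚᵘ (mkℚᵘ (ℤ.+ a) 0)) (ℚP.toℚᵘ-fromℚᵘ (mkℚᵘ (ℤ.+ b) 0)) ⟩
  mkℚᵘ (ℤ.+ a) 0 ℚᵘ.+ mkℚᵘ (ℤ.+ b) 0
    ≈⟨ *≡* (trans (sum-identity (ℤ.+ a) (ℤ.+ b)) (cong (ℤ._* (ℤ.1ℤ ℤ.* ℤ.1ℤ)) (sym (ℤP.pos-+ a b)))) ⟩
  mkℚᵘ (ℤ.+ (a + b)) 0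
    ≈⟨ ℚP.toℚᵘ-fromℚᵘ (mkℚᵘ (ℤ.+ (a + b)) 0) ⟨
  toℚᵘ (ℤ.+ (a + b) / 1) ∎)
  where
  open ℚᵘP.≃-Reasoning
  sum-identity : ∀ (x y : ℤ.ℤ) → (x ℤ.* ℤ.1ℤ ℤ.+ y ℤ.* ℤ.1ℤ) ℤ.* ℤ.1ℤ ≡ (x ℤ.+ y) ℤ.* (ℤ.1ℤ ℤ.* ℤ.1ℤ)
  sum-identity = ℤ-solve-∀

sumℚ-ℕ/1 : ∀ (xs : List A) f → sumℚ (map (λ x → ℤ.+ f x / 1) xs) ≡ ℤ.+ sumOver xs f / 1
sumℚ-ℕ/1 []       f = refl
sumℚ-ℕ/1 (x ∷ xs) f = trans (cong (ℤ.+ f x / 1 ℚ.+_) (sumℚ-ℕ/1 xs f)) (ℕ/1-+ (f x) (sumOver xs f))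

1/n*ℕ/1 : ∀ a n .{{_ : NonZero n}} → (ℤ.+ 1 / n) ℚ.* (ℤ.+ a / 1) ≡ ℤ.+ a / n
1/n*ℕ/1 a (suc n) = ℚP.toℚᵘ-injective (begin
  toℚᵘ ((ℤ.+ 1 / suc n) ℚ.* (ℤ.+ a / 1))
    ≈⟨ ℚP.toℚᵘ-homo-* (ℤ.+ 1 / suc n) (ℤ.+ a / 1) ⟩
  toℚᵘ (ℤ.+ 1 / suc n) ℚᵘ.* toℚᵘ (ℤ.+ a / 1)
    ≈⟨ ℚᵘP.*-cong (ℚP.toℚᵘ-fromℚᵘ (mkℚᵘ (ℤ.+ 1) n)) (ℚP.toℚᵘ-fromℚᵘ (mkℚᵘ (ℤ.+ a) 0)) ⟩
  mkℚᵘ (ℤ.+ 1) n ℚᵘ.* mkℚᵘ (ℤ.+ a) 0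
    ≈⟨ *≡* (product-identity (ℤ.+ a) (ℤ.+ suc n)) ⟩
  mkℚᵘ (ℤ.+ a) n
    ≈⟨ ℚP.toℚᵘ-fromℚᵘ (mkℚᵘ (ℤ.+ a) n) ⟨
  toℚᵘ (ℤ.+ a / suc n) ∎)
  where
  open ℚᵘP.≃-Reasoning
  product-identity : ∀ (x d : ℤ.ℤ) → (ℤ.1ℤ ℤ.* x) ℤ.* d ≡ x ℤ.* (d ℤ.* ℤ.1ℤ)
  product-identity = ℤ-solve-∀

/-cross : ∀ a b c d .{{_ : NonZero b}} .{{_ : NonZero d}} → a * d ≡ c * b → ℤ.+ a / b ≡ ℤ.+ c / d
/-cross a (suc b) c (suc d) ad≡cb =
  ℚP.fromℚᵘ-cong {mkℚᵘ (ℤ.+ a) b} {mkℚᵘ (ℤ.+ c) d}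
    (*≡* (trans (sym (ℤP.pos-* a (suc d))) (trans (cong ℤ.+_ ad≡cb) (ℤP.pos-* c (suc b)))))

/≡0⇒≡0 : ∀ a n .{{_ : NonZero n}} → ℤ.+ a / n ≡ 0ℚ → a ≡ 0
/≡0⇒≡0 a (suc n) a/n≡0 = trans (sym (ℕP.*-identityʳ a)) (ℚP.normalize-injective-≃ a 0 (suc n) 1 a/n≡0)

-- Monotonicity of winning

Borel-resp-≗ : ∀ {m} {A : Play m → Set} → Borel A → ∀ {p q : Play m} → (∀ k → p k ≡ q k) → A p → A q
Borel-resp-≗ (cylinder w)          p≗q Ap       = trans (sym (ListP.tabulate-cong (λ i → p≗q (toℕ i)))) Ap
Borel-resp-≗ (complement b)        p≗q ¬Ap Aq   = ¬Ap (Borel-resp-≗ b (sym ∘ p≗q) Aq)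
Borel-resp-≗ (countableUnion A bs) p≗q (k , Ap) = k , Borel-resp-≗ (bs k) p≗q Ap
Borel-resp-≗ (extensional b A⇔B)   p≗q Bp       =
  Equivalence.to (A⇔B _) (Borel-resp-≗ b p≗q (Equivalence.from (A⇔B _) Bp))

SatWins-mono : ∀ {m} (G : Game m) {T T′ : Fin m → Bool} →
               (∀ s → T s ≡ true → T′ s ≡ true) → SatWins G T → SatWins G T′
SatWins-mono {m} G {T} {T′} T⊆T′ (σ , σ-legal , σ-wins) =
  σ , σ-legal , λ τ τ-legal →
    Borel-resp-≗ borel (λ k → cong proj₂ (same-config τ k)) (σ-wins (copyσ τ) (copyσ-legal τ τ-legal))
  where
  open Game G
  -- Unsat imitates σ on the states Sat controls only in the larger game, so both games produce the same play.
  copyσ : Strategy m → Strategy m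
  copyσ τ h s = if T′ s then σ h s else τ h s
  copyσ-legal : ∀ τ → Legal G τ → Legal G (copyσ τ)
  copyσ-legal τ τ-legal h s with T′ s
  ... | true  = σ-legal h s
  ... | false = τ-legal h s
  same-move : ∀ τ h s b → T s ≡ b → (if b then σ h s else copyσ τ h s) ≡ (if T′ s then σ h s else τ h s)
  same-move τ h s true  Ts = cong (λ b → if b then σ h s else τ h s) (sym (T⊆T′ s Ts))
  same-move τ h s false _  = refl
  same-config : ∀ τ k → config G T σ (copyσ τ) k ≡ config G T′ σ τ k
  same-config τ zero    = refl
  same-config τ (suc k) with config G T σ (copyσ τ) k | config G T′ σ τ k | same-config τ k
  ... | h , s | .(h , s) | refl = cong ((s ∷ h) ,_) (same-move τ h s (T s) refl)

-- Importance as a weighted count of critical coalitions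

module _ {m n : ℕ} (G : Game m) (dec : ∀ T → Dec (SatWins G T)) (blk : Fin m → Maybe (Fin n)) where

  wins : Subset n → Bool
  wins J = does (dec (blocks blk J))

  wins-mono : ∀ {J K} → J ⊆ K → wins J ≡ true → wins K ≡ true
  wins-mono {J} {K} J⊆K J-wins =
    dec-true (dec (blocks blk K)) (SatWins-mono G blocks-mono (does≡true⇒ (dec (blocks blk J)) J-wins))
    where
    blocks-mono : ∀ s → blocks blk J s ≡ true → blocks blk K s ≡ true
    blocks-mono s with blk s
    ... | just j  = λ j∈J → VecP.[]=⇒lookup (J⊆K (VecP.lookup⇒[]= j J j∈J))
    ... | nothing = λ ()

  marginal : Fin n → Subset n → Bool
  marginal i J = wins (J ∪ ⁅ i ⁆) ∧ not (wins J)

  critical≡marginal : ∀ i J → does (critical? G dec blk i J) ≡ marginal i J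
  critical≡marginal i J = cong₂ _∧_ (is-1 (wins (J ∪ ⁅ i ⁆))) (is-0 (wins J))
    where
    is-1 : ∀ b → does ((if b then 1ℚ else 0ℚ) ℚP.≟ 1ℚ) ≡ b
    is-1 true  = refl
    is-1 false = refl
    is-0 : ∀ b → does ((if b then 1ℚ else 0ℚ) ℚP.≟ 0ℚ) ≡ not b
    is-0 true  = refl
    is-0 false = refl

  marginal-∈ : ∀ {i J} → i ∈ J → marginal i J ≡ false
  marginal-∈ {i} {J} i∈J =
    trans (cong (λ K → wins K ∧ not (wins J)) (∪-⁅⁆-absorb i∈J)) (BoolP.∧-inverseʳ (wins J))

  valB-marginal : ∀ i J → valB G dec blk (J ∪ ⁅ i ⁆) ℚ.- valB G dec blk J ≡ ℤ.+ 𝟙 (marginal i J) / 1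
  valB-marginal i J = difference (wins (J ∪ ⁅ i ⁆)) (wins J) (wins-mono (SubsetP.p⊆p∪q ⁅ i ⁆))
    where
    difference : ∀ x y → (y ≡ true → x ≡ true) →
                 (if x then 1ℚ else 0ℚ) ℚ.- (if y then 1ℚ else 0ℚ) ≡ ℤ.+ 𝟙 (x ∧ not y) / 1
    difference true  true  _   = refl
    difference true  false _   = refl
    difference false false _   = refl
    difference false true  y⇒x = case y⇒x refl of λ ()

  geq≡later∪ : ∀ π i → geq G dec blk π i ≡ later π i ∪ ⁅ i ⁆
  geq≡later∪ π i = lookup-ext pointwise
    where
    le : Fin n → Bool
    le j = toℕ (π i) ≤ᵇ toℕ (π j)
    pointwise : ∀ j → lookup (geq G dec blk π i) j ≡ lookup (later π i ∪ ⁅ i ⁆) j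
    pointwise j = begin
      lookup (geq G dec blk π i) j                 ≡⟨ VecP.lookup∘tabulate le j ⟩
      le j                                         ≡⟨ by-cases (j ≟ i) ⟩
      (le j ∧ not (does (j ≟ i))) ∨ lookup ⁅ i ⁆ j  ≡⟨ cong (_∨ lookup ⁅ i ⁆ j) (VecP.lookup∘tabulate _ j) ⟨
      lookup (later π i) j ∨ lookup ⁅ i ⁆ j         ≡⟨ VecP.lookup-zipWith _∨_ j (later π i) ⁅ i ⁆ ⟨
      lookup (later π i ∪ ⁅ i ⁆) j                  ∎
      where
      open ≡-Reasoning
      by-cases : (d : Dec (j ≡ i)) → le j ≡ (le j ∧ not (does d)) ∨ lookup ⁅ i ⁆ j
      by-cases (yes refl) = trans (Equivalence.to BoolP.T-≡ (ℕP.≤⇒≤ᵇ (ℕP.≤-refl {toℕ (π j)})))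
                                  (sym (trans (cong ((le j ∧ false) ∨_) (VecP.[]=⇒lookup (SubsetP.x∈⁅x⁆ j)))
                                              (BoolP.∨-zeroʳ (le j ∧ false))))
      by-cases (no j≢i)   = sym (trans (cong₂ _∨_ (BoolP.∧-identityʳ (le j))
                                                  (∉⇒lookup≡false (SubsetP.x≢y⇒x∉⁅y⁆ j≢i)))
                                       (BoolP.∨-identityʳ (le j)))

  criticalTerm : Subset n → Fin n → Subset n → ℕ
  criticalTerm P i J = 𝟙 (does (J ⊆? P) ∧ marginal i J) * shapleyWeight ∣ P ∣ ∣ J ∣

  criticalSum≡ : ∀ P i → criticalSum G dec blk P i ≡ ∑ˢ (criticalTerm P i)
  criticalSum≡ P i =
    trans (sumOver-filter (λ J → (J ⊆? P) ×-dec critical? G dec blk i J) (allSubsets n)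
                          (λ J → shapleyWeight ∣ P ∣ ∣ J ∣))
          (sumOver-cong (allSubsets n) λ J →
            cong (λ b → 𝟙 (does (J ⊆? P) ∧ b) * shapleyWeight ∣ P ∣ ∣ J ∣) (critical≡marginal i J))

  sum-marginal≡criticalSum : ∀ i →
                             sumOver (permutations n) (λ π → 𝟙 (marginal i (later π i))) ≡ criticalSum G dec blk ⊤ i
  sum-marginal≡criticalSum i = begin
    sumOver (permutations n) (λ π → 𝟙 (marginal i (later π i)))
      ≡⟨ sumOver-fibres (permutations n) (λ π → later π i) (λ J → 𝟙 (marginal i J)) ⟩
    ∑ˢ (λ J → 𝟙 (marginal i J) * sumOver (permutations n) (λ π → 𝟙 (does (later π i ≟ˢ J))))
      ≡⟨ sumOver-cong (allSubsets n) term ⟩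
    ∑ˢ (criticalTerm ⊤ i)
      ≡⟨ criticalSum≡ ⊤ i ⟨
    criticalSum G dec blk ⊤ i ∎
    where
    open ≡-Reasoning
    term : ∀ J → 𝟙 (marginal i J) * sumOver (permutations n) (λ π → 𝟙 (does (later π i ≟ˢ J))) ≡ criticalTerm ⊤ i J
    term J with i ∈? J
    ... | yes i∈J = trans (cong (λ b → 𝟙 b * _) (marginal-∈ i∈J))
                          (sym (cong (λ b → 𝟙 b * shapleyWeight ∣ ⊤ {n} ∣ ∣ J ∣)
                                     (trans (cong (does (J ⊆? ⊤) ∧_) (marginal-∈ i∈J)) (BoolP.∧-zeroʳ _))))
    ... | no i∉J  = cong₂ _*_ (cong (λ b → 𝟙 (b ∧ marginal i J)) (sym (dec-true (J ⊆? ⊤) SubsetP.⊆⊤)))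
                              (trans (#permutationsWithLater i J i∉J)
                                     (cong (λ p → shapleyWeight p ∣ J ∣) (sym (SubsetP.∣⊤∣≡n n))))

  importance≡ : ∀ i → importance G dec blk i ≡ (ℤ.+ criticalSum G dec blk ⊤ i / n !) {{n !≢0}}
  importance≡ i = begin
    importance G dec blk i
      ≡⟨ cong (λ xs → 1/n! ℚ.* sumℚ xs) (ListP.map-cong term (permutations n)) ⟩
    1/n! ℚ.* sumℚ (map (λ π → ℤ.+ 𝟙 (marginal i (later π i)) / 1) (permutations n))
      ≡⟨ cong (1/n! ℚ.*_) (sumℚ-ℕ/1 (permutations n) _) ⟩
    1/n! ℚ.* (ℤ.+ sumOver (permutations n) (λ π → 𝟙 (marginal i (later π i))) / 1)
      ≡⟨ 1/n*ℕ/1 (sumOver (permutations n) (λ π → 𝟙 (marginal i (later π i)))) (n !) ⟩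
    ℤ.+ sumOver (permutations n) (λ π → 𝟙 (marginal i (later π i))) / n !
      ≡⟨ cong (λ x → ℤ.+ x / n !) (sum-marginal≡criticalSum i) ⟩
    ℤ.+ criticalSum G dec blk ⊤ i / n ! ∎
    where
    open ≡-Reasoning
    instance _ = n !≢0
    1/n! = ℤ.+ 1 / n !
    term : ∀ π → valB G dec blk (geq G dec blk π i) ℚ.- valB G dec blk (geqMinus G dec blk π i)
                   ≡ ℤ.+ 𝟙 (marginal i (later π i)) / 1
    term π = trans (cong (λ K → valB G dec blk K ℚ.- valB G dec blk (later π i)) (geq≡later∪ π i))
                   (valB-marginal i (later π i))

  IsNull : Fin n → Set
  IsNull j = ∀ K → wins (K ∪ ⁅ j ⁆) ≡ wins K

  importance≡0⇒null : ∀ j → importance G dec blk j ≡ 0ℚ → IsNull j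
  importance≡0⇒null j importance≡0 K = no-gain (wins-mono (SubsetP.p⊆p∪q ⁅ j ⁆)) marginal≡false
    where
    instance _ = n !≢0
    criticalSum≡0 : criticalSum G dec blk ⊤ j ≡ 0
    criticalSum≡0 = /≡0⇒≡0 _ (n !) (trans (sym (importance≡ j)) importance≡0)
    term≡0 : criticalTerm ⊤ j K ≡ 0
    term≡0 = ∑ˢ-≡0 _ (trans (sym (criticalSum≡ ⊤ j)) criticalSum≡0) K
    instance _ = ℕP.m*n≢0 (∣ K ∣ !) ((∣ ⊤ {n} ∣ ∸ ∣ K ∣ ∸ 1) !) {{∣ K ∣ !≢0}} {{(∣ ⊤ {n} ∣ ∸ ∣ K ∣ ∸ 1) !≢0}}
    marginal≡false : marginal j K ≡ false
    marginal≡false = 𝟙≡0 (trans (cong (λ b → 𝟙 (b ∧ marginal j K)) (sym (dec-true (K ⊆? ⊤) SubsetP.⊆⊤)))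
                                (ℕP.m*n≡0⇒m≡0 _ (shapleyWeight ∣ ⊤ {n} ∣ ∣ K ∣) term≡0))
      where
      𝟙≡0 : ∀ {b} → 𝟙 b ≡ 0 → b ≡ false
      𝟙≡0 {false} _ = refl
    no-gain : ∀ {x y} → (y ≡ true → x ≡ true) → x ∧ not y ≡ false → x ≡ y
    no-gain {true}  {true}  _   _ = refl
    no-gain {false} {false} _   _ = refl
    no-gain {false} {true}  y⇒x _ = y⇒x refl

  marginal-∪null : ∀ {i j} → IsNull j → ∀ J → marginal i (J ∪ ⁅ j ⁆) ≡ marginal i J
  marginal-∪null {i} {j} null J = cong₂ (λ x y → x ∧ not y) (trans (cong wins swap) (null (J ∪ ⁅ i ⁆))) (null J)
    where
    swap : (J ∪ ⁅ j ⁆) ∪ ⁅ i ⁆ ≡ (J ∪ ⁅ i ⁆) ∪ ⁅ j ⁆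
    swap = trans (SubsetP.∪-assoc J ⁅ j ⁆ ⁅ i ⁆)
                 (trans (cong (J ∪_) (SubsetP.∪-comm ⁅ j ⁆ ⁅ i ⁆)) (sym (SubsetP.∪-assoc J ⁅ i ⁆ ⁅ j ⁆)))

  criticalTerm-∪null : ∀ {i j P J} → IsNull j → j ∉ P → i ∈ P → j ∉ J →
                       criticalTerm (P ∪ ⁅ j ⁆) i J + criticalTerm (P ∪ ⁅ j ⁆) i (J ∪ ⁅ j ⁆)
                         ≡ suc ∣ P ∣ * criticalTerm P i J
  criticalTerm-∪null {i} {j} {P} {J} null j∉P i∈P j∉J = begin
    criticalTerm (P ∪ ⁅ j ⁆) i J + criticalTerm (P ∪ ⁅ j ⁆) i (J ∪ ⁅ j ⁆)
      ≡⟨ cong₂ _+_ term≡ term∪≡ ⟩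
    𝟙 b * shapleyWeight (suc ∣ P ∣) ∣ J ∣ + 𝟙 b * shapleyWeight (suc ∣ P ∣) (suc ∣ J ∣)
      ≡⟨ 𝟙*shapleyWeight-step b bound ⟩
    suc ∣ P ∣ * criticalTerm P i J ∎
    where
    open ≡-Reasoning
    b = does (J ⊆? P) ∧ marginal i J
    same-⊆ : does (J ⊆? P ∪ ⁅ j ⁆) ≡ does (J ⊆? P)
    same-⊆ = does-⇔ (⊆-∪⁅⁆⇔ j∉J) (J ⊆? P ∪ ⁅ j ⁆) (J ⊆? P)
    same-⊆′ : does (J ∪ ⁅ j ⁆ ⊆? P ∪ ⁅ j ⁆) ≡ does (J ⊆? P)
    same-⊆′ = does-⇔ (∪⁅⁆-⊆-∪⁅⁆⇔ j∉J) (J ∪ ⁅ j ⁆ ⊆? P ∪ ⁅ j ⁆) (J ⊆? P)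
    term≡ : criticalTerm (P ∪ ⁅ j ⁆) i J ≡ 𝟙 b * shapleyWeight (suc ∣ P ∣) ∣ J ∣
    term≡ = cong₂ (λ c p → 𝟙 (c ∧ marginal i J) * shapleyWeight p ∣ J ∣) same-⊆ (∣∪⁅⁆∣ j∉P)
    term∪≡ : criticalTerm (P ∪ ⁅ j ⁆) i (J ∪ ⁅ j ⁆) ≡ 𝟙 b * shapleyWeight (suc ∣ P ∣) (suc ∣ J ∣)
    term∪≡ = trans (cong₂ (λ c a → 𝟙 c * shapleyWeight ∣ P ∪ ⁅ j ⁆ ∣ a)
                          (cong₂ _∧_ same-⊆′ (marginal-∪null null J)) (∣∪⁅⁆∣ j∉J))
                   (cong (λ p → 𝟙 b * shapleyWeight p (suc ∣ J ∣)) (∣∪⁅⁆∣ j∉P))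
    bound : b ≡ true → suc ∣ J ∣ ≤ ∣ P ∣
    bound b≡true = SubsetP.p⊂q⇒∣p∣<∣q∣ (J⊆P , i , i∈P , i∉J)
      where
      J⊆P : J ⊆ P
      J⊆P = does≡true⇒ (J ⊆? P) (proj₁ (∧≡true b≡true))
      i∉J : i ∉ J
      i∉J i∈J = case trans (sym (proj₂ (∧≡true {does (J ⊆? P)} b≡true))) (marginal-∈ i∈J) of λ ()

  criticalTerm-∉ : ∀ {i j P J} → j ∉ P → j ∈ J → criticalTerm P i J ≡ 0
  criticalTerm-∉ {i} {j} {P} {J} j∉P j∈J =
    cong (λ b → 𝟙 (b ∧ marginal i J) * shapleyWeight ∣ P ∣ ∣ J ∣) (dec-false (J ⊆? P) (λ J⊆P → j∉P (J⊆P j∈J)))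

  criticalSum-∪null : ∀ {i j P} → IsNull j → j ∉ P → i ∈ P →
                      criticalSum G dec blk (P ∪ ⁅ j ⁆) i ≡ suc ∣ P ∣ * criticalSum G dec blk P i
  criticalSum-∪null {i} {j} {P} null j∉P i∈P = begin
    criticalSum G dec blk (P ∪ ⁅ j ⁆) i                      ≡⟨ criticalSum≡ (P ∪ ⁅ j ⁆) i ⟩
    ∑ˢ (criticalTerm (P ∪ ⁅ j ⁆) i)                          ≡⟨ ∑ˢ-split j (criticalTerm (P ∪ ⁅ j ⁆) i) ⟩
    ∑ˢ (λ J → if lookup J j then 0 else pair J)              ≡⟨ sumOver-cong (allSubsets n) pair≡ ⟩
    ∑ˢ (λ J → suc ∣ P ∣ * criticalTerm P i J)                ≡⟨ sumOver-*ˡ (allSubsets n) (suc ∣ P ∣) _ ⟩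
    suc ∣ P ∣ * ∑ˢ (criticalTerm P i)                        ≡⟨ cong (suc ∣ P ∣ *_) (criticalSum≡ P i) ⟨
    suc ∣ P ∣ * criticalSum G dec blk P i                    ∎
    where
    open ≡-Reasoning
    pair : Subset n → ℕ
    pair J = criticalTerm (P ∪ ⁅ j ⁆) i J + criticalTerm (P ∪ ⁅ j ⁆) i (J ∪ ⁅ j ⁆)
    pair≡ : ∀ J → (if lookup J j then 0 else pair J) ≡ suc ∣ P ∣ * criticalTerm P i J
    pair≡ J with lookup J j in Jj
    ... | true  = sym (trans (cong (suc ∣ P ∣ *_) (criticalTerm-∉ {J = J} j∉P (VecP.lookup⇒[]= j J Jj)))
                             (ℕP.*-zeroʳ (suc ∣ P ∣)))
    ... | false = criticalTerm-∪null {J = J} null j∉P i∈P (λ j∈J → case trans (sym (VecP.[]=⇒lookup j∈J)) Jj of λ ())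

  criticalSum-⊤ : ∀ {i I} → i ∈ I → (∀ j → j ∉ I → IsNull j) →
                  criticalSum G dec blk ⊤ i * ∣ I ∣ ! ≡ criticalSum G dec blk I i * n !
  criticalSum-⊤ {i} {I} i∈I nulls =
    trans (grow (n ∸ ∣ I ∣) I (λ x∈I → x∈I) (ℕP.m+[n∸m]≡n (SubsetP.∣p∣≤n I)) refl)
          (cong (λ k → criticalSum G dec blk I i * k !) (SubsetP.∣⊤∣≡n n))
    where
    Balanced : Subset n → Set
    Balanced P = criticalSum G dec blk P i * ∣ I ∣ ! ≡ criticalSum G dec blk I i * ∣ P ∣ !
    extend : ∀ {P j} → I ⊆ P → j ∉ P → Balanced P → Balanced (P ∪ ⁅ j ⁆)
    extend {P} {j} I⊆P j∉P balanced = begin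
      cs (P ∪ ⁅ j ⁆) * ∣ I ∣ !   ≡⟨ cong (_* ∣ I ∣ !) (criticalSum-∪null (nulls j (j∉P ∘ I⊆P)) j∉P (I⊆P i∈I)) ⟩
      suc ∣ P ∣ * cs P * ∣ I ∣ !  ≡⟨ ℕP.*-assoc (suc ∣ P ∣) (cs P) (∣ I ∣ !) ⟩
      suc ∣ P ∣ * (cs P * ∣ I ∣ !) ≡⟨ cong (suc ∣ P ∣ *_) balanced ⟩
      suc ∣ P ∣ * (cs I * ∣ P ∣ !) ≡⟨ *-left-comm (suc ∣ P ∣) (cs I) (∣ P ∣ !) ⟩
      cs I * suc ∣ P ∣ !          ≡⟨ cong (λ k → cs I * k !) (∣∪⁅⁆∣ j∉P) ⟨
      cs I * ∣ P ∪ ⁅ j ⁆ ∣ !      ∎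
      where
      open ≡-Reasoning
      cs : Subset n → ℕ
      cs P = criticalSum G dec blk P i
    grow : ∀ k P → I ⊆ P → ∣ P ∣ + k ≡ n → Balanced P → Balanced ⊤
    grow zero    P _   size balanced =
      subst Balanced (SubsetP.∣p∣≡n⇒p≡⊤ (trans (sym (ℕP.+-identityʳ ∣ P ∣)) size)) balanced
    grow (suc k) P I⊆P size balanced with FinP.any? (λ j → ¬? (j ∈? P))
    ... | yes (j , j∉P) =
      grow k (P ∪ ⁅ j ⁆) (λ x∈I → SubsetP.p⊆p∪q ⁅ j ⁆ (I⊆P x∈I))
           (trans (cong (_+ k) (∣∪⁅⁆∣ j∉P)) (trans (sym (ℕP.+-suc ∣ P ∣ k)) size))
           (extend I⊆P j∉P balanced)
    ... | no ∄j∉P = contradiction (trans (cong (_+ suc k) (sym ∣P∣≡n)) size) (ℕP.m+1+n≢m n)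
      where
      P≡⊤ : P ≡ ⊤
      P≡⊤ = SubsetP.⊆-antisym SubsetP.⊆⊤ (λ {j} _ → decidable-stable (j ∈? P) (λ j∉P → ∄j∉P (j , j∉P)))
      ∣P∣≡n : ∣ P ∣ ≡ n
      ∣P∣≡n = trans (cong ∣_∣ P≡⊤) (SubsetP.∣⊤∣≡n n)

open import Data.Integer using (+_)

mainTheorem3 : ∀ {m n : ℕ} (G : Game m) (dec : ∀ T → Dec (SatWins G T))
    (blk : Fin m → Maybe (Fin n)) → IsPartition n blk →
    (I : Subset n) →
    (∀ (j : Fin n) → j ∉ I → importance G dec blk j ≡ 0ℚ) →
    ∀ (i : Fin n) → i ∈ I →
    importance G dec blk i ≡ (+ criticalSum G dec blk I i / (∣ I ∣ !)) {{∣ I ∣ !≢0}}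
mainTheorem3 {n = n} G dec blk _ I unimportant i i∈I =
  trans (importance≡ G dec blk i)
        (/-cross (criticalSum G dec blk ⊤ i) (n !) (criticalSum G dec blk I i) (∣ I ∣ !) {{n !≢0}} {{∣ I ∣ !≢0}}
                 (criticalSum-⊤ G dec blk i∈I (λ j j∉I → importance≡0⇒null G dec blk j (unimportant j j∉I))))
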